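{- Let $w$ be a finite word, $z$ a Lyndon word that is a factor of $w$, and $m>0$ an integer such that $[z]_m\subseteq F(w)$. Then the Rauzy graph $\Gamma_w(m-1)$ contains a circuit whose set of arcs is $[z]_m$.
   Context: Fix a total order on letters and the induced lexicographic order. $F(w)$ is the set of factors of $w$ (including the empty word), $F_w(\ell)$ those of length $\ell$. For a non-empty word $z$, $[z]=\{z[i..|z|]\,z[1..i-1]: 1\le i\le|z|\}$; for a non-empty word $x$ and $m\ge0$, $x^{m/|x|}$ is the length-$m$ prefix of the infinite word $xxx\cdots$; $[z]_m=\{x^{m/|x|}:x\in[z]\}$. A Lyndon word is a primitive word (not of the form $x^k$, $k\ge 2$) that is lexicographically smallest in its conjugacy class. The Rauzy graph $\Gamma_w(\ell)$ is the directed multigraph with vertex set $F_w(\ell)$ and arc set $F_w(\ell+1)$, an arc $u$ going from $u[1..\ell]$ to $u[2..\ell+1]$. A circuit is a sequence of arcs $(u_1,\dots,u_k)$ such that the terminal vertex of $u_i$ is the initial vertex of $u_{i+1}$ for $i<k$, and the terminal vertex of $u_k$ is the initial vertex of $u_1$. -}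

module Defs where

open import Level using (Level)
open import Data.Nat using (ℕ; zero; suc; _<_; _≤_; _∸_)
open import Data.List using (List; []; _∷_; _++_; length; take; drop; concat; replicate)
open import Data.List.Relation.Unary.All using (All)
open import Data.List.Relation.Unary.Linked using (Linked)
open import Data.List.Membership.Propositional using (_∈_)
open import Data.Product using (Σ; ∃; ∃-syntax; _×_; _,_)
open import Relation.Binary.Core using (Rel)
open import Relation.Binary.PropositionalEquality using (_≡_; _≢_)
open import Relation.Nullary using (¬_)

module Words {A : Set} (_<ₐ_ : Rel A Level.zero) where

  Word : Set
  Word = List A

  -- F(w): u is a factor of w (the empty word included)
  Factor : Word → Word → Set
  Factor u w = ∃[ x ] ∃[ y ] (x ++ u ++ y ≡ w)

  FactorOfLength : Word → ℕ → Word → Set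
  FactorOfLength w ℓ u = Factor u w × length u ≡ ℓ

  data _≤lex_ : Word → Word → Set where
    []≤   : ∀ {v} → [] ≤lex v
    head< : ∀ {a b u v} → a <ₐ b → (a ∷ u) ≤lex (b ∷ v)
    head≡ : ∀ {a u v} → u ≤lex v → (a ∷ u) ≤lex (a ∷ v)

  power : Word → ℕ → Word
  power x k = concat (replicate k x)

  Primitive : Word → Set
  Primitive z = z ≢ [] × ¬ (∃[ x ] ∃[ k ] (2 ≤ k × z ≡ power x k))

  rotate : ℕ → Word → Word
  rotate i z = drop i z ++ take i z

  Conjugate : Word → Word → Set
  Conjugate z x = ∃[ i ] (i < length z × x ≡ rotate i z)

  Lyndon : Word → Set
  Lyndon z = Primitive z × (∀ x → Conjugate z x → z ≤lex x)

  -- x^{m/|x|}: the length-m prefix of xxx⋯ (for non-empty x; m copies suffice)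
  fracPow : Word → ℕ → Word
  fracPow x m = take m (power x m)

  InConjPow : Word → ℕ → Word → Set
  InConjPow z m v = ∃[ x ] (Conjugate z x × v ≡ fracPow x m)

  -- Rauzy graph Γ_w(ℓ): arcs are the factors of length ℓ+1
  Arc : Word → ℕ → Word → Set
  Arc w ℓ u = FactorOfLength w (suc ℓ) u

  initial : ℕ → Word → Word
  initial ℓ u = take ℓ u

  terminal : Word → Word
  terminal u = drop 1 u

  Follows : ℕ → Rel Word Level.zero
  Follows ℓ u u′ = terminal u ≡ initial ℓ u′

  IsCircuit : Word → ℕ → Word → List Word → Set
  IsCircuit w ℓ u₁ us =
    All (Arc w ℓ) (u₁ ∷ us) × Linked (Follows ℓ) ((u₁ ∷ us) ++ (u₁ ∷ []))

-- The conjugates of z, read cyclically, form a closed walk: if a conjugate is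
-- a·y, the next one is y·a, and the length-m prefixes of (a·y)^ω and (y·a)^ω
-- overlap in the length-(m−1) prefix of y·(a·y)^ω, so each arc of [z]_m ends
-- where the next one starts. After |z| rotations we are back at z, closing
-- the circuit, and by hypothesis every such arc is a factor of w.
module Submission where

open import Defs
open import Level using (0ℓ)
open import Data.Nat using (ℕ; zero; suc; _>_; _∸_; _≤_; _<_; _⊓_; z≤n; s≤s)
open import Data.Nat.Properties using (≤-refl; ≤-reflexive; ≤-trans; m≤n⇒m⊓n≡m; n≤1+n; m≤n+m)
open import Data.List using (List; []; _∷_; _++_; _∷ʳ_; take; drop; length; applyUpTo)
open import Data.List.Properties
  using (++-assoc; ++-identityʳ; length-++; length-take; take-take; take-all; drop-all; applyUpTo-∷ʳ)
open import Data.List.Membership.Propositional using (_∈_)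
open import Data.List.Membership.Propositional.Properties using (∈-applyUpTo⁺; ∈-applyUpTo⁻)
import Data.List.Relation.Unary.All as All
open import Data.List.Relation.Unary.Linked using (Linked)
open import Data.List.Relation.Unary.Linked.Properties using (applyUpTo⁺₁)
open import Data.Product using (∃-syntax; _×_; _,_)
open import Data.Empty using (⊥-elim)
open import Function.Base using (_∘_)
open import Function.Bundles using (_⇔_; mk⇔; Equivalence)
open import Relation.Binary.Core using (Rel)
open import Relation.Binary.PropositionalEquality
open import Relation.Binary.Structures using (IsStrictTotalOrder)

module _ {A : Set} where

  length-++-≥ʳ : ∀ (xs ys : List A) → length ys ≤ length (xs ++ ys)
  length-++-≥ʳ xs ys = ≤-trans (m≤n+m _ (length xs)) (≤-reflexive (sym (length-++ xs)))

  take-++-≤ : ∀ n (xs ys : List A) → n ≤ length xs → take n (xs ++ ys) ≡ take n xs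
  take-++-≤ zero    xs       ys _       = refl
  take-++-≤ (suc n) (x ∷ xs) ys (s≤s p) = cong (x ∷_) (take-++-≤ n xs ys p)

  drop-take-suc : ∀ i (z : List A) → i < length z →
                  ∃[ a ] (drop i z ≡ a ∷ drop (suc i) z × take (suc i) z ≡ take i z ∷ʳ a)
  drop-take-suc zero    (x ∷ z) _       = x , refl , refl
  drop-take-suc (suc i) (x ∷ z) (s≤s p) with a , d , t ← drop-take-suc i z p = a , d , cong (x ∷_) t

module Conjugates {A : Set} (_<ₐ_ : Rel A 0ℓ) where
  open Words _<ₐ_

  length-power-∷ : ∀ (a : A) y k → k ≤ length (power (a ∷ y) k)
  length-power-∷ a y zero    = z≤n
  length-power-∷ a y (suc k) = s≤s (≤-trans (length-power-∷ a y k) (length-++-≥ʳ y _))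

  length-fracPow-∷ : ∀ (a : A) y m → length (fracPow (a ∷ y) m) ≡ m
  length-fracPow-∷ a y m = trans (length-take m _) (m≤n⇒m⊓n≡m (length-power-∷ a y m))

  ∷-power-∷ʳ : ∀ (a : A) y k → a ∷ power (y ∷ʳ a) k ≡ power (a ∷ y) k ∷ʳ a
  ∷-power-∷ʳ a y zero    = refl
  ∷-power-∷ʳ a y (suc k) = begin
    a ∷ ((y ∷ʳ a) ++ power (y ∷ʳ a) k)  ≡⟨ cong (a ∷_) (++-assoc y _ _) ⟩
    a ∷ (y ++ a ∷ power (y ∷ʳ a) k)     ≡⟨ cong (λ t → a ∷ (y ++ t)) (∷-power-∷ʳ a y k) ⟩
    a ∷ (y ++ (power (a ∷ y) k ∷ʳ a))   ≡⟨ cong (a ∷_) (sym (++-assoc y _ _)) ⟩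
    a ∷ ((y ++ power (a ∷ y) k) ∷ʳ a)   ∎
    where open ≡-Reasoning

  fracPow-rotate-follows : ∀ (a : A) y ℓ →
    Follows ℓ (fracPow (a ∷ y) (suc ℓ)) (fracPow (y ∷ʳ a) (suc ℓ))
  fracPow-rotate-follows a y ℓ = sym (begin
    take ℓ (take (suc ℓ) (power (y ∷ʳ a) (suc ℓ)))  ≡⟨ take-take ℓ (suc ℓ) _ ⟩
    take (ℓ ⊓ suc ℓ) (power (y ∷ʳ a) (suc ℓ))        ≡⟨ cong (λ j → take j (power (y ∷ʳ a) (suc ℓ))) (m≤n⇒m⊓n≡m (n≤1+n ℓ)) ⟩
    take ℓ ((y ∷ʳ a) ++ power (y ∷ʳ a) ℓ)            ≡⟨ cong (take ℓ) (++-assoc y _ _) ⟩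
    take ℓ (y ++ a ∷ power (y ∷ʳ a) ℓ)               ≡⟨ cong (λ t → take ℓ (y ++ t)) (∷-power-∷ʳ a y ℓ) ⟩
    take ℓ (y ++ (power (a ∷ y) ℓ ∷ʳ a))             ≡⟨ cong (take ℓ) (sym (++-assoc y _ _)) ⟩
    take ℓ ((y ++ power (a ∷ y) ℓ) ∷ʳ a)             ≡⟨ take-++-≤ ℓ _ _ prefix-long ⟩
    take ℓ (y ++ power (a ∷ y) ℓ)                    ∎)
    where
      open ≡-Reasoning
      prefix-long : ℓ ≤ length (y ++ power (a ∷ y) ℓ)
      prefix-long = ≤-trans (length-power-∷ a y ℓ) (length-++-≥ʳ y _)

  rotate-suc : ∀ i (z : List A) → i < length z →
               ∃[ a ] ∃[ y ] (rotate i z ≡ a ∷ y × rotate (suc i) z ≡ y ∷ʳ a)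
  rotate-suc i z i<|z| with a , drop≡ , take≡ ← drop-take-suc i z i<|z| =
    a , drop (suc i) z ++ take i z , cong (_++ take i z) drop≡ ,
    trans (cong (drop (suc i) z ++_) take≡) (sym (++-assoc (drop (suc i) z) _ _))

  rotate-length : ∀ (z : List A) → rotate (length z) z ≡ rotate 0 z
  rotate-length z = begin
    drop (length z) z ++ take (length z) z  ≡⟨ cong₂ _++_ (drop-all _ z ≤-refl) (take-all _ z ≤-refl) ⟩
    z                                       ≡⟨ sym (++-identityʳ z) ⟩
    z ++ []                                 ∎
    where open ≡-Reasoning

  conjugateArc : List A → ℕ → ℕ → List A
  conjugateArc z ℓ i = fracPow (rotate i z) (suc ℓ)

  conjugateArcs : List A → ℕ → List (List A)
  conjugateArcs z ℓ = applyUpTo (conjugateArc z ℓ) (length z)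

  length-conjugateArc : ∀ z ℓ i → i < length z → length (conjugateArc z ℓ i) ≡ suc ℓ
  length-conjugateArc z ℓ i i<|z| with a , y , rot≡ , _ ← rotate-suc i z i<|z| rewrite rot≡ =
    length-fracPow-∷ a y (suc ℓ)

  conjugateArc-follows : ∀ z ℓ i → i < length z →
                         Follows ℓ (conjugateArc z ℓ i) (conjugateArc z ℓ (suc i))
  conjugateArc-follows z ℓ i i<|z| with a , y , rot≡ , rot-suc≡ ← rotate-suc i z i<|z|
    rewrite rot≡ | rot-suc≡ = fracPow-rotate-follows a y ℓ

  conjugateArcs-closed-linked : ∀ z ℓ →
    Linked (Follows ℓ) (conjugateArcs z ℓ ∷ʳ conjugateArc z ℓ 0)
  conjugateArcs-closed-linked z ℓ =
    subst (Linked (Follows ℓ)) closes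
      (applyUpTo⁺₁ f (suc (length z)) λ { (s≤s i<|z|) → conjugateArc-follows z ℓ _ i<|z| })
    where
      f : ℕ → List A
      f = conjugateArc z ℓ
      closes : applyUpTo f (suc (length z)) ≡ conjugateArcs z ℓ ∷ʳ f 0
      closes = begin
        applyUpTo f (suc (length z))      ≡⟨ applyUpTo-∷ʳ f (length z) ⟨
        conjugateArcs z ℓ ∷ʳ f (length z) ≡⟨ cong (λ x → conjugateArcs z ℓ ∷ʳ fracPow x (suc ℓ)) (rotate-length z) ⟩
        conjugateArcs z ℓ ∷ʳ f 0          ∎
        where open ≡-Reasoning

  ∈-conjugateArcs⇔ : ∀ z ℓ v → v ∈ conjugateArcs z ℓ ⇔ InConjPow z (suc ℓ) v
  ∈-conjugateArcs⇔ z ℓ v = mk⇔ to from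
    where
      to : v ∈ conjugateArcs z ℓ → InConjPow z (suc ℓ) v
      to v∈ with i , i<|z| , refl ← ∈-applyUpTo⁻ (conjugateArc z ℓ) v∈ = rotate i z , (i , i<|z| , refl) , refl
      from : InConjPow z (suc ℓ) v → v ∈ conjugateArcs z ℓ
      from (_ , (i , i<|z| , refl) , refl) = ∈-applyUpTo⁺ (conjugateArc z ℓ) i<|z|

lemma4 : {A : Set} (_<ₐ_ : Rel A 0ℓ) → IsStrictTotalOrder _≡_ _<ₐ_ →
         let open Words _<ₐ_ in
         (w z : List A) (m : ℕ) →
         Lyndon z → Factor z w → m > 0 →
         (∀ v → InConjPow z m v → Factor v w) →
         ∃[ u₁ ] ∃[ us ] (IsCircuit w (m ∸ 1) u₁ us ×
                          (∀ v → (v ∈ u₁ ∷ us) ⇔ InConjPow z m v))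
lemma4 _<ₐ_ _ w [] m ((z≢[] , _) , _) _ _ _ = ⊥-elim (z≢[] refl)
lemma4 _<ₐ_ _ w z@(_ ∷ _) (suc ℓ) _ _ _ [z]ₘ⊆F =
  conjugateArc z ℓ 0 , applyUpTo (conjugateArc z ℓ ∘ suc) _ ,
  (All.tabulate isArc , conjugateArcs-closed-linked z ℓ) , ∈-conjugateArcs⇔ z ℓ
  where
    open Conjugates _<ₐ_
    isArc : ∀ {v} → v ∈ conjugateArcs z ℓ → Words.Arc _<ₐ_ w ℓ v
    isArc {v} v∈ with i , i<|z| , refl ← ∈-applyUpTo⁻ (conjugateArc z ℓ) v∈ =
      [z]ₘ⊆F v (Equivalence.to (∈-conjugateArcs⇔ z ℓ v) v∈) , length-conjugateArc z ℓ i i<|z|
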